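{- Let $\mathbf L=(L,\lor,\land,*,1)$ be a lattice skew Hilbert algebra and $\Theta$ a congruence of $\mathbf L$. Then $[1]\Theta$ is a filter of $\mathbf L$, and for all $x,y\in L$: $(x,y)\in\Theta$ if and only if $x*y,\,y*x\in[1]\Theta$; that is, $\Phi([1]\Theta)=\Theta$.
   Context: A lattice skew Hilbert algebra is an algebra $(L,\lor,\land,*,1)$ where $(L,\lor,\land)$ is a lattice and the identities $x*(x\lor y)\approx1$, $x*((x*y)*y)\approx1$, $((x\lor y)*z)*(x*z)\approx1$, $(x\lor y)\land(x*y)\approx y$ hold. A filter of $\mathbf L$ is a subset $F\subseteq L$ containing $1$ such that for all $x,y,z,v\in L$, if $x*y,y*x,z*v,v*z\in F$ then $(x\lor z)*(y\lor v)$, $(x\land z)*(y\land v)$, $(x*z)*(y*v)\in F$. For $M\subseteq L$, $\Phi(M):=\{(x,y)\in L^2\mid x*y,y*x\in M\}$. Congruences are those of the algebra $(L,\lor,\land,*,1)$. -}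

module Defs where

open import Level using (Level; _⊔_; suc)
open import Data.Product using (_×_; _,_)
open import Relation.Binary.PropositionalEquality using (_≡_)
open import Relation.Binary.Structures using (IsEquivalence)
open import Algebra.Lattice.Structures using (IsLattice)

record LatticeSkewHilbertAlgebra (a : Level) : Set (suc a) where
  infixr 6 _∨_
  infixr 7 _∧_
  infixr 5 _*_
  field
    Carrier   : Set a
    _∨_       : Carrier → Carrier → Carrier
    _∧_       : Carrier → Carrier → Carrier
    _*_       : Carrier → Carrier → Carrier
    𝟏         : Carrier
    isLattice : IsLattice _≡_ _∨_ _∧_
    ax1 : ∀ x y → x * (x ∨ y) ≡ 𝟏
    ax2 : ∀ x y → x * ((x * y) * y) ≡ 𝟏
    ax3 : ∀ x y z → ((x ∨ y) * z) * (x * z) ≡ 𝟏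
    ax4 : ∀ x y → (x ∨ y) ∧ (x * y) ≡ y

module _ {a : Level} (𝐋 : LatticeSkewHilbertAlgebra a) where
  open LatticeSkewHilbertAlgebra 𝐋

  Subset : (ℓ : Level) → Set (a ⊔ suc ℓ)
  Subset ℓ = Carrier → Set ℓ

  record IsCongruence {ℓ : Level} (Θ : Carrier → Carrier → Set ℓ) : Set (a ⊔ ℓ) where
    field
      isEquivalence : IsEquivalence Θ
      ∨-cong : ∀ {x y z v} → Θ x y → Θ z v → Θ (x ∨ z) (y ∨ v)
      ∧-cong : ∀ {x y z v} → Θ x y → Θ z v → Θ (x ∧ z) (y ∧ v)
      *-cong : ∀ {x y z v} → Θ x y → Θ z v → Θ (x * z) (y * v)

  IsFilter : {ℓ : Level} → Subset ℓ → Set (a ⊔ ℓ)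
  IsFilter F =
    F 𝟏 ×
    (∀ x y z v → F (x * y) → F (y * x) → F (z * v) → F (v * z) →
       F ((x ∨ z) * (y ∨ v)) × F ((x ∧ z) * (y ∧ v)) × F ((x * z) * (y * v)))

  classOf1 : {ℓ : Level} → (Carrier → Carrier → Set ℓ) → Subset ℓ
  classOf1 Θ x = Θ x 𝟏

  Φ : {ℓ : Level} → Subset ℓ → Carrier → Carrier → Set ℓ
  Φ M x y = M (x * y) × M (y * x)

-- In a lattice skew Hilbert algebra x * x = 1 and x ∧ 1 = x, so the identity
-- (x ∨ y) ∧ (x * y) = y shows that x * y Θ 1 forces y Θ x ∨ y.  Applying this
-- to both x * y and y * x gives x Θ x ∨ y = y ∨ x Θ y; conversely x Θ y gives
-- x * y Θ y * y = 1.  Hence Θ = Φ([1]Θ), and [1]Θ is a filter because Θ is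
-- compatible with ∨, ∧ and *.
module Submission where

open import Defs
open import Level using (Level)
open import Data.Product using (_×_; _,_)
open import Function.Bundles using (_⇔_; mk⇔)
open import Relation.Binary.PropositionalEquality using (_≡_; refl; sym; cong; cong₂; module ≡-Reasoning)
open import Relation.Binary.Structures using (IsEquivalence)
open import Algebra.Lattice.Bundles using (Lattice)
import Algebra.Lattice.Properties.Lattice as LatticeProperties

module SkewHilbertProperties {a : Level} (𝐋 : LatticeSkewHilbertAlgebra a) where
  open LatticeSkewHilbertAlgebra 𝐋

  lattice : Lattice a a
  lattice = record { isLattice = isLattice }

  open LatticeProperties lattice using (∨-idem)

  *-self : ∀ x → x * x ≡ 𝟏
  *-self x = begin
    x * x        ≡⟨ cong (x *_) (∨-idem x) ⟨
    x * (x ∨ x)  ≡⟨ ax1 x x ⟩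
    𝟏            ∎
    where open ≡-Reasoning

  ∧-identityʳ : ∀ x → x ∧ 𝟏 ≡ x
  ∧-identityʳ x = begin
    x ∧ 𝟏              ≡⟨ cong₂ _∧_ (∨-idem x) (*-self x) ⟨
    (x ∨ x) ∧ (x * x)  ≡⟨ ax4 x x ⟩
    x                  ∎
    where open ≡-Reasoning

module CongruenceProperties {a ℓ : Level} (𝐋 : LatticeSkewHilbertAlgebra a)
    {Θ : LatticeSkewHilbertAlgebra.Carrier 𝐋 → LatticeSkewHilbertAlgebra.Carrier 𝐋 → Set ℓ}
    (isCongruence : IsCongruence 𝐋 Θ) where
  open LatticeSkewHilbertAlgebra 𝐋
  open SkewHilbertProperties 𝐋
  open IsCongruence isCongruence
  open IsEquivalence isEquivalence renaming (refl to Θ-refl; sym to Θ-sym; trans to Θ-trans)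
  open Lattice lattice using (∨-comm)

  ≡⇒Θ : ∀ {x y} → x ≡ y → Θ x y
  ≡⇒Θ refl = Θ-refl

  Θ⇒*-Θ-𝟏 : ∀ {x y} → Θ x y → Θ (x * y) 𝟏
  Θ⇒*-Θ-𝟏 {y = y} x-Θ-y = Θ-trans (*-cong x-Θ-y Θ-refl) (≡⇒Θ (*-self y))

  *-Θ-𝟏⇒Θ-∨ : ∀ {x y} → Θ (x * y) 𝟏 → Θ y (x ∨ y)
  *-Θ-𝟏⇒Θ-∨ {x} {y} xy-Θ-𝟏 =
    Θ-trans (≡⇒Θ (sym (ax4 x y)))
      (Θ-trans (∧-cong Θ-refl xy-Θ-𝟏) (≡⇒Θ (∧-identityʳ (x ∨ y))))

  Φ⇒Θ : ∀ {x y} → Θ (x * y) 𝟏 → Θ (y * x) 𝟏 → Θ x y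
  Φ⇒Θ {x} {y} xy-Θ-𝟏 yx-Θ-𝟏 =
    Θ-trans (*-Θ-𝟏⇒Θ-∨ yx-Θ-𝟏)
      (Θ-trans (≡⇒Θ (∨-comm y x)) (Θ-sym (*-Θ-𝟏⇒Θ-∨ xy-Θ-𝟏)))

  Θ⇔Φ : ∀ x y → Θ x y ⇔ Φ 𝐋 (classOf1 𝐋 Θ) x y
  Θ⇔Φ x y = mk⇔ (λ x-Θ-y → Θ⇒*-Θ-𝟏 x-Θ-y , Θ⇒*-Θ-𝟏 (Θ-sym x-Θ-y))
                (λ (xy-Θ-𝟏 , yx-Θ-𝟏) → Φ⇒Θ xy-Θ-𝟏 yx-Θ-𝟏)

  classOf1-isFilter : IsFilter 𝐋 (classOf1 𝐋 Θ)
  classOf1-isFilter = Θ-refl , λ x y z v xy yx zv vz →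
    let x-Θ-y = Φ⇒Θ xy yx
        z-Θ-v = Φ⇒Θ zv vz
    in Θ⇒*-Θ-𝟏 (∨-cong x-Θ-y z-Θ-v) , Θ⇒*-Θ-𝟏 (∧-cong x-Θ-y z-Θ-v) , Θ⇒*-Θ-𝟏 (*-cong x-Θ-y z-Θ-v)

mainTheorem8 : ∀ {a ℓ : Level} (𝐋 : LatticeSkewHilbertAlgebra a)
    (Θ : LatticeSkewHilbertAlgebra.Carrier 𝐋 → LatticeSkewHilbertAlgebra.Carrier 𝐋 → Set ℓ) →
    IsCongruence 𝐋 Θ →
    IsFilter 𝐋 (classOf1 𝐋 Θ) ×
    (∀ x y → Θ x y ⇔ Φ 𝐋 (classOf1 𝐋 Θ) x y)
mainTheorem8 𝐋 Θ isCongruence = classOf1-isFilter , Θ⇔Φ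
  where open CongruenceProperties 𝐋 isCongruence
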